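{- Let $K$ be a complete multipartite graph with vertices labeled $1,2,\dots,n$. Then there is a bijection between the acyclic orientations of $K$ and the canonical topological sorts of $K$.
   Context: Given a directed acyclic graph, a topological sort is a total ordering $\tau$ of the vertices such that $\tau(u)<\tau(v)$ for every directed edge $(u,v)$. Every total ordering of the vertices of an undirected graph $G$ induces an acyclic orientation of $G$ (orient each edge from the earlier to the later vertex). Two vertices are incomparable in a directed acyclic graph if there is no directed path from either to the other; in a total ordering of the vertices of $G$, two vertices are incomparable if they are incomparable in the induced acyclic orientation. A canonical topological sort of $G$ is a total ordering of its vertices in which every pair of incomparable vertices appears in increasing numerical order. A complete multipartite graph has vertex set partitioned into parts, with two vertices adjacent iff they lie in different parts. -}

module Defs where

open import Data.Nat using (ℕ)
open import Data.Fin using (Fin; _<_)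
open import Data.Bool using (Bool; true; false)
open import Data.Vec using (Vec; lookup)
open import Data.Product using (Σ; ∃; _×_; _,_; proj₁)
open import Data.Sum using (_⊎_)
open import Relation.Binary.PropositionalEquality using (_≡_; _≢_)
open import Relation.Nullary using (¬_)

-- A complete multipartite graph on vertex set Fin n (vertices 1..n labelled
-- 0..n-1, order preserved) is given by a part assignment  part : Fin n → ℕ;
-- two vertices are adjacent iff they lie in different parts.
Adj : ∀ {n} → (Fin n → ℕ) → Fin n → Fin n → Set
Adj part u v = part u ≢ part v

data Path {n} (R : Fin n → Fin n → Set) : Fin n → Fin n → Set where
  step : ∀ {u v} → R u v → Path R u v
  _∷_  : ∀ {u v w} → R u v → Path R v w → Path R u w

Arc : ∀ {n} → Vec (Vec Bool n) n → Fin n → Fin n → Set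
Arc M u v = lookup (lookup M u) v ≡ true

IsOrientation : ∀ {n} → (Fin n → ℕ) → Vec (Vec Bool n) n → Set
IsOrientation part M =
  (∀ u v → Adj part u v →
      (Arc M u v × ¬ Arc M v u) ⊎ (Arc M v u × ¬ Arc M u v))
  × (∀ u v → ¬ Adj part u v → ¬ Arc M u v)

IsAcyclicOrientation : ∀ {n} → (Fin n → ℕ) → Vec (Vec Bool n) n → Set
IsAcyclicOrientation part M =
  IsOrientation part M × (∀ v → ¬ Path (Arc M) v v)

AcyclicOrientation : ∀ {n} → (Fin n → ℕ) → Set
AcyclicOrientation {n} part = Σ (Vec (Vec Bool n) n) (IsAcyclicOrientation part)

-- Total orderings: a vector σ listing the vertices, σ[i] is the vertex at
-- position i; all entries distinct (so σ is a permutation of Fin n).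

IsTotalOrdering : ∀ {n} → Vec (Fin n) n → Set
IsTotalOrdering σ = ∀ i j → lookup σ i ≡ lookup σ j → i ≡ j

InducedArc : ∀ {n} → (Fin n → ℕ) → Vec (Fin n) n → Fin n → Fin n → Set
InducedArc part σ a b =
  Adj part a b × Σ (Fin _) λ i → Σ (Fin _) λ j →
    i < j × lookup σ i ≡ a × lookup σ j ≡ b

Incomparable : ∀ {n} → (Fin n → ℕ) → Vec (Fin n) n → Fin n → Fin n → Set
Incomparable part σ a b =
  ¬ Path (InducedArc part σ) a b × ¬ Path (InducedArc part σ) b a

IsCanonicalTopSort : ∀ {n} → (Fin n → ℕ) → Vec (Fin n) n → Set
IsCanonicalTopSort part σ =
  IsTotalOrdering σ ×
  (∀ i j → i < j → Incomparable part σ (lookup σ i) (lookup σ j) →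
     lookup σ i < lookup σ j)

CanonicalTopSort : ∀ {n} → (Fin n → ℕ) → Set
CanonicalTopSort {n} part = Σ (Vec (Fin n) n) (IsCanonicalTopSort part)

-- Bijection between two subtypes Σ A P and Σ B Q, where elements are
-- identified by their underlying data (proof components are ignored, so
-- the notion does not depend on proof-relevance of P and Q).

record SubBijection {A B : Set} (P : A → Set) (Q : B → Set) : Set where
  field
    to      : Σ A P → Σ B Q
    from    : Σ B Q → Σ A P
    from∘to : ∀ x → proj₁ (from (to x)) ≡ proj₁ x
    to∘from : ∀ y → proj₁ (to (from y)) ≡ proj₁ y

-- In an acyclic orientation of a complete multipartite graph every directed path can be shortened to one
-- of length at most two, so reachability is decidable and is a strict weak order in which only vertices of
-- the same part can be incomparable. Ordering incomparable vertices by label refines it to a strict total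
-- order; listing the vertices in this order is a canonical topological sort that induces the orientation.
-- Conversely, a canonical sort lists its vertices increasingly for the order obtained from its own induced
-- orientation, and a strictly increasing listing of a finite total order is unique.

module Submission where

open import Defs
open import Data.Nat using (ℕ)
open import Data.Fin using (Fin)

open import Level using (Level; _⊔_)
import Data.Nat as ℕ
import Data.Nat.Properties as ℕ
open import Data.Fin using (suc; toℕ; fromℕ; fromℕ<; inject₁; punchOut; _<_; _≤_)
open import Data.Fin.Properties
  using (_≟_; _<?_; any?; <-cmp; <-irrefl; <-asym; <-trans; <⇒≢; ≤-antisym; <-isStrictTotalOrder;
         toℕ-fromℕ<; toℕ-inject₁; ≤fromℕ; ≤̄⇒inject₁<; pigeonhole; punchOut-injective)
open import Data.Fin.Induction using (<-weakInduction; >-weakInduction)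
open import Data.Fin.Subset using (Subset; _∈_; _⊂_; ∣_∣)
open import Data.Fin.Subset.Properties using (p⊂q⇒∣p∣<∣q∣; ∣⊤∣≡n; ∈⊤; ⊆⊤)
open import Data.Bool using (Bool; true)
open import Data.Bool.Properties using (⇔→≡; T-≡) renaming (_≟_ to _≟ᵇ_)
open import Data.Vec using (Vec; lookup; tabulate)
open import Data.Vec.Properties using (lookup∘tabulate; tabulate∘lookup; tabulate-cong; []=⇒lookup; lookup⇒[]=)
open import Data.Product using (∃; _×_; _,_; proj₁; proj₂)
open import Data.Sum using (_⊎_; inj₁; inj₂; [_,_]′)
import Data.Sum as Sum
open import Data.Empty using (⊥-elim)
open import Function using (id; _∘_; _⇔_; mk⇔; Equivalence; Injective)
open import Function.Properties.Equivalence using () renaming (trans to ⇔-trans)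
open import Relation.Binary using (Rel; Decidable; Transitive; Asymmetric; IsStrictTotalOrder; tri<; tri≈; tri>)
open import Relation.Binary.PropositionalEquality using (_≡_; _≢_; refl; sym; trans; cong; subst; subst₂)
open import Relation.Nullary using (¬_; Dec; yes; no; contradiction)
open import Relation.Nullary.Decidable using (isYes; toWitness; fromWitness; _×-dec_; _⊎-dec_; ¬?)
open import Relation.Unary using (Pred) renaming (Decidable to Decidable₁)

open Equivalence using (to; from)

private
  variable
    a ℓ r : Level
    n : ℕ

injective⇒surjective : {f : Fin n → Fin n} → Injective _≡_ _≡_ f → ∀ y → ∃ λ x → f x ≡ y
injective⇒surjective {ℕ.suc m} {f} f-inj y with any? (λ x → f x ≟ y)
... | yes hit = hit
... | no miss =
  let i , j , i<j , pᵢ≡pⱼ = pigeonhole (ℕ.n<1+n m) (λ x → punchOut (y≢f x))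
  in contradiction (f-inj (punchOut-injective (y≢f i) (y≢f j) pᵢ≡pⱼ)) (<⇒≢ i<j)
  where
  y≢f : ∀ x → y ≢ f x
  y≢f x y≡fx = miss (x , sym y≡fx)

strictlyIncreasing⇒≗id : (f : Fin n → Fin n) → (∀ {i j} → i < j → f i < f j) → ∀ i → f i ≡ i
strictlyIncreasing⇒≗id {ℕ.suc m} f f-mono k = ≤-antisym (below k) (above k)
  where
  inject₁<suc : ∀ (i : Fin m) → f (inject₁ i) < f (suc i)
  inject₁<suc i = f-mono (≤̄⇒inject₁< ℕ.≤-refl)

  above : ∀ i → i ≤ f i
  above = <-weakInduction (λ i → i ≤ f i) ℕ.z≤n λ i i≤fi →
    subst (ℕ._< toℕ (f (suc i))) (toℕ-inject₁ i) (ℕ.≤-<-trans i≤fi (inject₁<suc i))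

  below : ∀ i → f i ≤ i
  below = >-weakInduction (λ i → f i ≤ i) (≤fromℕ (f (fromℕ m))) λ i fi≤i →
    subst (toℕ (f (inject₁ i)) ℕ.≤_) (sym (toℕ-inject₁ i))
      (ℕ.s≤s⁻¹ (ℕ.<-≤-trans (inject₁<suc i) fi≤i))

isYes≡true⇔ : {A : Set a} (a? : Dec A) → isYes a? ≡ true ⇔ A
isYes≡true⇔ a? = mk⇔ (toWitness {a? = a?} ∘ from T-≡) (to T-≡ ∘ fromWitness {a? = a?})

satisfying : {P : Pred (Fin n) ℓ} → Decidable₁ P → Subset n
satisfying P? = tabulate (isYes ∘ P?)

∈-satisfying : {P : Pred (Fin n) ℓ} (P? : Decidable₁ P) {x : Fin n} → x ∈ satisfying P? ⇔ P x
∈-satisfying P? {x} = mk⇔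
  (to (isYes≡true⇔ (P? x)) ∘ trans (sym (lookup∘tabulate _ x)) ∘ []=⇒lookup)
  (lookup⇒[]= x _ ∘ trans (lookup∘tabulate _ x) ∘ from (isYes≡true⇔ (P? x)))

relationMatrix : {R : Rel (Fin n) ℓ} → Decidable R → Vec (Vec Bool n) n
relationMatrix R? = tabulate λ u → tabulate λ v → isYes (R? u v)

Arc-relationMatrix : {R : Rel (Fin n) ℓ} (R? : Decidable R) {u v : Fin n} →
                     Arc (relationMatrix R?) u v ⇔ R u v
Arc-relationMatrix R? {u} {v} =
  subst (λ b → b ≡ true ⇔ _) (sym lookup-relationMatrix) (isYes≡true⇔ (R? u v))
  where
  lookup-relationMatrix : lookup (lookup (relationMatrix R?) u) v ≡ isYes (R? u v)
  lookup-relationMatrix = trans (cong (λ row → lookup row v) (lookup∘tabulate _ u)) (lookup∘tabulate _ v)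

lookup-ext : {A : Set a} {xs ys : Vec A n} → (∀ i → lookup xs i ≡ lookup ys i) → xs ≡ ys
lookup-ext {xs = xs} {ys} same =
  trans (sym (tabulate∘lookup xs)) (trans (tabulate-cong same) (tabulate∘lookup ys))

matrix-ext : {M N : Vec (Vec Bool n) n} → (∀ u v → Arc M u v ⇔ Arc N u v) → M ≡ N
matrix-ext same = lookup-ext λ u → lookup-ext λ v → ⇔→≡ (same u v)

module _ {R : Fin n → Fin n → Set} where

  _++ₚ_ : ∀ {u v w} → Path R u v → Path R v w → Path R u w
  step r  ++ₚ q = r ∷ q
  (r ∷ p) ++ₚ q = r ∷ (p ++ₚ q)

  Path-map : {S : Fin n → Fin n → Set} → (∀ {u v} → R u v → S u v) →
             ∀ {u v} → Path R u v → Path S u v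
  Path-map f (step r) = step (f r)
  Path-map f (r ∷ p)  = f r ∷ Path-map f p

BreakTies : {A : Set a} → Rel A ℓ → Rel A r → Rel A (ℓ ⊔ r)
BreakTies _<_ R u v = R u v ⊎ (¬ R v u × u < v)

-- R-split is negative transitivity, so R is a strict weak order and incomparability is an equivalence:
-- this is what makes BreakTies transitive.
module TieBreaking {A : Set a} {_<_ : Rel A ℓ} (<-sto : IsStrictTotalOrder _≡_ _<_)
                   {R : Rel A r} (R? : Decidable R) (R-asym : Asymmetric R)
                   (R-split : ∀ {u v} w → R u v → R u w ⊎ R w v) where

  module STO = IsStrictTotalOrder <-sto

  _≺_ : Rel A (ℓ ⊔ r)
  _≺_ = BreakTies _<_ R

  R-trans : Transitive R
  R-trans uRv vRw = [ id , (λ wRv → contradiction wRv (R-asym vRw)) ]′ (R-split _ uRv)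

  ≺-irrefl : ∀ {u} → ¬ u ≺ u
  ≺-irrefl (inj₁ uRu)       = R-asym uRu uRu
  ≺-irrefl (inj₂ (_ , u<u)) = STO.irrefl refl u<u

  ≺-trans : Transitive _≺_
  ≺-trans (inj₁ uRv)          (inj₁ vRw)          = inj₁ (R-trans uRv vRw)
  ≺-trans (inj₁ uRv)          (inj₂ (¬wRv , _))   = inj₁ ([ id , ⊥-elim ∘ ¬wRv ]′ (R-split _ uRv))
  ≺-trans (inj₂ (¬vRu , _))   (inj₁ vRw)          = inj₁ ([ ⊥-elim ∘ ¬vRu , id ]′ (R-split _ vRw))
  ≺-trans (inj₂ (¬vRu , u<v)) (inj₂ (¬wRv , v<w)) =
    inj₂ ((λ wRu → [ ¬wRv , ¬vRu ]′ (R-split _ wRu)) , STO.trans u<v v<w)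

  ≺-total : ∀ {u v} → u ≢ v → u ≺ v ⊎ v ≺ u
  ≺-total {u} {v} u≢v with R? u v | R? v u | STO.compare u v
  ... | yes uRv | _       | _              = inj₁ (inj₁ uRv)
  ... | no _    | yes vRu | _              = inj₂ (inj₁ vRu)
  ... | no _    | no ¬vRu | tri< u<v _ _   = inj₁ (inj₂ (¬vRu , u<v))
  ... | no _    | no _    | tri≈ _ u≡v _   = contradiction u≡v u≢v
  ... | no ¬uRv | no _    | tri> _ _ v<u   = inj₂ (inj₂ (¬uRv , v<u))

  _≺?_ : Decidable _≺_
  u ≺? v = R? u v ⊎-dec (¬? (R? v u) ×-dec (u STO.<? v))

module Ranking {_≺_ : Rel (Fin n) ℓ} (_≺?_ : Decidable _≺_)
               (≺-irrefl : ∀ {u} → ¬ u ≺ u) (≺-trans : Transitive _≺_)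
               (≺-total : ∀ {u v} → u ≢ v → u ≺ v ⊎ v ≺ u) where

  predecessors : Fin n → Subset n
  predecessors v = satisfying (_≺? v)

  predecessors-⊂ : ∀ {u v} → u ≺ v → predecessors u ⊂ predecessors v
  predecessors-⊂ {u} u≺v =
    (λ x≺u → from (∈-satisfying _) (≺-trans (to (∈-satisfying _) x≺u) u≺v)) ,
    u , from (∈-satisfying _) u≺v , ≺-irrefl ∘ to (∈-satisfying _)

  ∣predecessors∣<n : ∀ v → ∣ predecessors v ∣ ℕ.< n
  ∣predecessors∣<n v = subst (∣ predecessors v ∣ ℕ.<_) (∣⊤∣≡n n)
    (p⊂q⇒∣p∣<∣q∣ (⊆⊤ , v , ∈⊤ , ≺-irrefl ∘ to (∈-satisfying _)))

  rank : Fin n → Fin n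
  rank v = fromℕ< (∣predecessors∣<n v)

  rank-mono : ∀ {u v} → u ≺ v → rank u < rank v
  rank-mono u≺v =
    subst₂ ℕ._<_ (sym (toℕ-fromℕ< _)) (sym (toℕ-fromℕ< _)) (p⊂q⇒∣p∣<∣q∣ (predecessors-⊂ u≺v))

  rank-injective : Injective _≡_ _≡_ rank
  rank-injective {u} {v} ru≡rv with u ≟ v
  ... | yes u≡v = u≡v
  ... | no u≢v  = ⊥-elim ([ (λ u≺v → <⇒≢ (rank-mono u≺v) ru≡rv) ,
                             (λ v≺u → <⇒≢ (rank-mono v≺u) (sym ru≡rv)) ]′ (≺-total u≢v))

  sorted : Fin n → Fin n
  sorted i = proj₁ (injective⇒surjective rank-injective i)

  rank-sorted : ∀ i → rank (sorted i) ≡ i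
  rank-sorted i = proj₂ (injective⇒surjective rank-injective i)

  sorted-rank : ∀ v → sorted (rank v) ≡ v
  sorted-rank v = rank-injective (rank-sorted (rank v))

  sorted-injective : Injective _≡_ _≡_ sorted
  sorted-injective {i} {j} eq = trans (sym (rank-sorted i)) (trans (cong rank eq) (rank-sorted j))

  sorted-mono : ∀ {i j} → i < j → sorted i ≺ sorted j
  sorted-mono {i} {j} i<j = [ id , (λ j≺i → contradiction (sorted-reflects j≺i) (<-asym i<j)) ]′
                              (≺-total (<⇒≢ i<j ∘ sorted-injective))
    where
    sorted-reflects : sorted j ≺ sorted i → j < i
    sorted-reflects j≺i = subst₂ _<_ (rank-sorted j) (rank-sorted i) (rank-mono j≺i)

  sorted-unique : (τ : Fin n → Fin n) → (∀ {i j} → i < j → τ i ≺ τ j) → ∀ i → sorted i ≡ τ i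
  sorted-unique τ τ-mono i = trans (cong sorted (sym (rank∘τ≗id i))) (sorted-rank (τ i))
    where
    rank∘τ≗id : ∀ i → rank (τ i) ≡ i
    rank∘τ≗id = strictlyIncreasing⇒≗id (rank ∘ τ) (λ i<j → rank-mono (τ-mono i<j))

TwoStep : Vec (Vec Bool n) n → Fin n → Fin n → Set
TwoStep M u v = ∃ λ x → Arc M u x × Arc M x v

Reach : Vec (Vec Bool n) n → Fin n → Fin n → Set
Reach M u v = Arc M u v ⊎ TwoStep M u v

reach? : (M : Vec (Vec Bool n) n) → Decidable (Reach M)
reach? M u v = arc? u v ⊎-dec any? (λ x → arc? u x ×-dec arc? x v)
  where
  arc? : Decidable (Arc M)
  arc? u v = lookup (lookup M u) v ≟ᵇ true

inducedArc? : (part : Fin n → ℕ) (σ : Vec (Fin n) n) → Decidable (InducedArc part σ)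
inducedArc? part σ u v = ¬? (part u ℕ.≟ part v) ×-dec
  any? (λ i → any? (λ j → (i <? j) ×-dec ((lookup σ i ≟ u) ×-dec (lookup σ j ≟ v))))

inducedMatrix : (Fin n → ℕ) → Vec (Fin n) n → Vec (Vec Bool n) n
inducedMatrix part σ = relationMatrix (inducedArc? part σ)

module AcyclicOrientation (part : Fin n → ℕ) (M : Vec (Vec Bool n) n)
                          (acyclic : IsAcyclicOrientation part M) where

  arc⇒adj : ∀ {u v} → Arc M u v → Adj part u v
  arc⇒adj {u} {v} uv u∼v = proj₂ (proj₁ acyclic) u v (λ u≁v → u≁v u∼v) uv

  adj⇒arc : ∀ {u v} → Adj part u v → Arc M u v ⊎ Arc M v u
  adj⇒arc {u} {v} u≁v = Sum.map proj₁ proj₁ (proj₁ (proj₁ acyclic) u v u≁v)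

  no-cycle : ∀ {v} → ¬ Path (Arc M) v v
  no-cycle = proj₂ acyclic _

  reach⇒path : ∀ {u v} → Reach M u v → Path (Arc M) u v
  reach⇒path (inj₁ uv)            = step uv
  reach⇒path (inj₂ (_ , ux , xv)) = ux ∷ step xv

  -- A path u → x ⇝ v closes up: x and v (or u and v) are adjacent, and the backward arc would give a cycle.
  path⇒reach : ∀ {u v} → Path (Arc M) u v → Reach M u v
  path⇒reach (step uv) = inj₁ uv
  path⇒reach {u} {v} (_∷_ {v = x} ux xv) with part u ℕ.≟ part v
  ... | no u≁v  = [ inj₁ , (λ vu → ⊥-elim (no-cycle ((ux ∷ xv) ++ₚ step vu))) ]′ (adj⇒arc u≁v)
  ... | yes u∼v = [ (λ xv′ → inj₂ (_ , ux , xv′)) , (λ vx → ⊥-elim (no-cycle (xv ++ₚ step vx))) ]′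
                    (adj⇒arc (λ x∼v → arc⇒adj ux (trans u∼v (sym x∼v))))

  reach-asym : Asymmetric (Reach M)
  reach-asym uv vu = no-cycle (reach⇒path uv ++ₚ reach⇒path vu)

  reach-split : ∀ {u v} w → Reach M u v → Reach M u w ⊎ Reach M w v
  reach-split {u} {v} w uv with part u ℕ.≟ part w
  ... | no u≁w  = Sum.map inj₁ (λ wu → path⇒reach (wu ∷ reach⇒path uv)) (adj⇒arc u≁w)
  ... | yes u∼w with part w ℕ.≟ part v
  ...   | no w≁v = Sum.swap (Sum.map inj₁ (λ vw → path⇒reach (reach⇒path uv ++ₚ step vw)) (adj⇒arc w≁v))
  ...   | yes w∼v with uv
  ...     | inj₁ uv′            = ⊥-elim (arc⇒adj uv′ (trans u∼w w∼v))
  ...     | inj₂ (x , ux , xv) =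
    Sum.swap (Sum.map (λ wx → inj₂ (x , wx , xv)) (λ xw → inj₂ (x , ux , xw))
                      (adj⇒arc (λ w∼x → arc⇒adj ux (trans u∼w w∼x))))

  open TieBreaking <-isStrictTotalOrder (reach? M) reach-asym reach-split
    using (_≺_; _≺?_; ≺-irrefl; ≺-trans; ≺-total) public
  open Ranking _≺?_ ≺-irrefl ≺-trans ≺-total using (rank; sorted; rank-mono; rank-sorted; sorted-rank;
                                                      sorted-injective; sorted-mono; sorted-unique) public

  canonicalSort : Vec (Fin n) n
  canonicalSort = tabulate sorted

  lookup-canonicalSort : ∀ i → lookup canonicalSort i ≡ sorted i
  lookup-canonicalSort = lookup∘tabulate sorted

  rank-canonicalSort : ∀ i → rank (lookup canonicalSort i) ≡ i
  rank-canonicalSort i = trans (cong rank (lookup-canonicalSort i)) (rank-sorted i)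

  arc⇒inducedArc : ∀ {u v} → Arc M u v → InducedArc part canonicalSort u v
  arc⇒inducedArc {u} {v} uv =
    arc⇒adj uv , rank u , rank v , rank-mono (inj₁ (inj₁ uv)) ,
    trans (lookup-canonicalSort _) (sorted-rank u) , trans (lookup-canonicalSort _) (sorted-rank v)

  inducedArc⇒arc : ∀ {u v} → InducedArc part canonicalSort u v → Arc M u v
  inducedArc⇒arc (u≁v , i , j , i<j , refl , refl) = [ id , backwards ]′ (adj⇒arc u≁v)
    where
    backwards : Arc M (lookup canonicalSort j) (lookup canonicalSort i) →
                Arc M (lookup canonicalSort i) (lookup canonicalSort j)
    backwards vu = contradiction
      (subst₂ _<_ (rank-canonicalSort j) (rank-canonicalSort i) (rank-mono (inj₁ (inj₁ vu)))) (<-asym i<j)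

  canonicalSort-isCanonicalTopSort : IsCanonicalTopSort part canonicalSort
  canonicalSort-isCanonicalTopSort = isTotalOrdering , incomparable⇒<
    where
    isTotalOrdering : IsTotalOrdering canonicalSort
    isTotalOrdering i j eq =
      sorted-injective (trans (sym (lookup-canonicalSort i)) (trans eq (lookup-canonicalSort j)))

    incomparable⇒< : ∀ i j → i < j →
                     Incomparable part canonicalSort (lookup canonicalSort i) (lookup canonicalSort j) →
                     lookup canonicalSort i < lookup canonicalSort j
    incomparable⇒< i j i<j (no-path , _) =
      subst₂ _<_ (sym (lookup-canonicalSort i)) (sym (lookup-canonicalSort j)) (ordered (sorted-mono i<j))
      where
      ordered : sorted i ≺ sorted j → sorted i < sorted j
      ordered (inj₁ reach)    = ⊥-elim (no-path (subst₂ (Path (InducedArc part canonicalSort))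
                                  (sym (lookup-canonicalSort i)) (sym (lookup-canonicalSort j))
                                  (Path-map arc⇒inducedArc (reach⇒path reach))))
      ordered (inj₂ (_ , lt)) = lt

  inducedMatrix-canonicalSort : inducedMatrix part canonicalSort ≡ M
  inducedMatrix-canonicalSort = matrix-ext {M = inducedMatrix part canonicalSort} {N = M} λ u v →
    ⇔-trans (Arc-relationMatrix (inducedArc? part canonicalSort)) (mk⇔ inducedArc⇒arc arc⇒inducedArc)

module TotalOrdering (part : Fin n → ℕ) (σ : Vec (Fin n) n) (σ-total : IsTotalOrdering σ) where

  position : Fin n → Fin n
  position u = proj₁ (injective⇒surjective (σ-total _ _) u)

  lookup-position : ∀ u → lookup σ (position u) ≡ u
  lookup-position u = proj₂ (injective⇒surjective (σ-total _ _) u)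

  position-lookup : ∀ i → position (lookup σ i) ≡ i
  position-lookup i = σ-total _ _ (lookup-position (lookup σ i))

  inducedArc⇒position< : ∀ {u v} → InducedArc part σ u v → position u < position v
  inducedArc⇒position< (_ , i , j , i<j , refl , refl) =
    subst₂ _<_ (sym (position-lookup i)) (sym (position-lookup j)) i<j

  path⇒position< : ∀ {u v} → Path (InducedArc part σ) u v → position u < position v
  path⇒position< (step uv)  = inducedArc⇒position< uv
  path⇒position< (uv ∷ vw) = <-trans (inducedArc⇒position< uv) (path⇒position< vw)

  M : Vec (Vec Bool n) n
  M = inducedMatrix part σ

  Arc-M : ∀ {u v} → Arc M u v ⇔ InducedArc part σ u v
  Arc-M = Arc-relationMatrix (inducedArc? part σ)

  inducedMatrix-isAcyclicOrientation : IsAcyclicOrientation part M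
  inducedMatrix-isAcyclicOrientation = (orientation , nonedge) , λ v p →
    <-irrefl refl (path⇒position< (Path-map (to Arc-M) p))
    where
    oriented : ∀ {u v} → Adj part u v → position u < position v → Arc M u v × ¬ Arc M v u
    oriented {u} {v} u≁v pu<pv =
      from Arc-M (u≁v , _ , _ , pu<pv , lookup-position u , lookup-position v) ,
      <-asym pu<pv ∘ inducedArc⇒position< ∘ to Arc-M

    orientation : ∀ u v → Adj part u v → (Arc M u v × ¬ Arc M v u) ⊎ (Arc M v u × ¬ Arc M u v)
    orientation u v u≁v with <-cmp (position u) (position v)
    ... | tri< pu<pv _ _ = inj₁ (oriented u≁v pu<pv)
    ... | tri≈ _ pu≡pv _ = ⊥-elim (u≁v (cong part (trans (sym (lookup-position u))
                                                         (trans (cong (lookup σ) pu≡pv) (lookup-position v)))))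
    ... | tri> _ _ pv<pu = inj₂ (oriented (u≁v ∘ sym) pv<pu)

    nonedge : ∀ u v → ¬ Adj part u v → ¬ Arc M u v
    nonedge u v u∼v uv = u∼v (proj₁ (to Arc-M uv))

  open AcyclicOrientation part M inducedMatrix-isAcyclicOrientation
    using (_≺_; path⇒reach; reach⇒path; sorted-unique; canonicalSort)

  canonicalSort-inducedMatrix : IsCanonicalTopSort part σ → canonicalSort ≡ σ
  canonicalSort-inducedMatrix (_ , incomparable⇒<) =
    trans (tabulate-cong (sorted-unique (lookup σ) increasing)) (tabulate∘lookup σ)
    where
    no-back-path : ∀ {i j} → i < j → ¬ Path (InducedArc part σ) (lookup σ j) (lookup σ i)
    no-back-path i<j p = <-asym i<j (subst₂ _<_ (position-lookup _) (position-lookup _) (path⇒position< p))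

    increasing : ∀ {i j} → i < j → lookup σ i ≺ lookup σ j
    increasing {i} {j} i<j with reach? M (lookup σ i) (lookup σ j)
    ... | yes reach = inj₁ reach
    ... | no ¬reach = inj₂ (no-back-reach , incomparable⇒< i j i<j (no-path , no-back-path i<j))
      where
      no-path : ¬ Path (InducedArc part σ) (lookup σ i) (lookup σ j)
      no-path p = ¬reach (path⇒reach (Path-map (from Arc-M) p))
      no-back-reach : ¬ Reach M (lookup σ j) (lookup σ i)
      no-back-reach r = no-back-path i<j (Path-map (to Arc-M) (reach⇒path r))

lemma5p3 : (n : ℕ) (part : Fin n → ℕ) →
    SubBijection (IsAcyclicOrientation part) (IsCanonicalTopSort part)
lemma5p3 n part = record
  { to      = λ { (M , acyclic) → canonicalSort M acyclic , canonicalSort-isCanonicalTopSort M acyclic }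
  ; from    = λ { (σ , σ-total , _) → inducedMatrix part σ , inducedMatrix-isAcyclicOrientation σ σ-total }
  ; from∘to = λ { (M , acyclic) → inducedMatrix-canonicalSort M acyclic }
  ; to∘from = λ { (σ , canonical@(σ-total , _)) → canonicalSort-inducedMatrix σ σ-total canonical }
  }
  where
  open AcyclicOrientation part
    using (canonicalSort; canonicalSort-isCanonicalTopSort; inducedMatrix-canonicalSort)
  open TotalOrdering part using (inducedMatrix-isAcyclicOrientation; canonicalSort-inducedMatrix)
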